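{- Let $\mathcal{M}$ be a matroid of rank three, and let $e,f\in E(\mathcal{M})$ be distinct. If $g\in E(\mathcal{M})\setminus\{e,f\}$ is such that $\{e,f,g\}$ is dependent in $\mathcal{M}$, then every coefficient of the polynomial $\Delta M\{e,f\}(\mathbf{y})-\Delta M^{g}\{e,f\}(\mathbf{y})$ is nonnegative, where $\Delta M^g\{e,f\}=M_e^{fg}M_f^{eg}-M_{ef}^{g}M^{efg}$.
   Context: Let $\mathcal{M}$ be a matroid on a finite ground set $E$, with indeterminates $\mathbf{y}=\{y_c:c\in E\}$; for $A\subseteq E$ write $\mathbf{y}^A=\prod_{e\in A}y_e$. For disjoint $I,J\subseteq E$ let $\mathcal{M}_I^J=\{B\setminus I : B \text{ a basis of } \mathcal{M},\ I\subseteq B\subseteq E\setminus J\}$ (empty if $I$ is dependent) and $M_I^J(\mathbf{y})=\sum_{A\in\mathcal{M}_I^J}\mathbf{y}^A$; subscripts and superscripts list the elements of $I$ and $J$ (e.g. $M_e^{fg}=M_{\{e\}}^{\{f,g\}}$, $M_{ef}^g=M_{\{e,f\}}^{\{g\}}$, $M^{efg}=M_\emptyset^{\{e,f,g\}}$). For distinct $e,f$, $\Delta M\{e,f\}=M_e^fM_f^e-M_{ef}M^{ef}$. -}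

module Defs where

open import Data.Nat using (ℕ; zero; suc)
open import Data.Integer as ℤ using (ℤ)
open import Data.Bool using (Bool; true; false; if_then_else_)
open import Data.Fin using (Fin)
open import Data.Fin.Subset using (Subset; _∈_; _∉_; _⊆_; _∩_; _∪_; _─_; _-_; ⁅_⁆; ∣_∣; ⊥; inside; outside)
open import Data.Fin.Subset.Properties using (_⊆?_)
open import Data.Vec using (Vec; []; _∷_; zipWith; replicate)
import Data.Vec as Vec
open import Data.Vec.Properties using (≡-dec)
import Data.Nat.Properties as ℕP
import Data.Bool.Properties as BP
open import Data.List using (List; []; _∷_; map; filter; concatMap; _++_)
open import Data.Product using (Σ; ∃; _×_; _,_; proj₁; proj₂)
open import Relation.Nullary using (¬_; Dec; yes; no)
open import Relation.Nullary.Decidable using (_×-dec_; ¬?)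
open import Relation.Unary using (Decidable)
open import Relation.Binary.PropositionalEquality using (_≡_)

record Matroid (n : ℕ) : Set₁ where
  field
    Basis    : Subset n → Set
    basis?   : Decidable Basis
    someBasis : ∃ Basis
    exchange : ∀ {B₁ B₂} → Basis B₁ → Basis B₂ → ∀ {x} → x ∈ B₁ → x ∉ B₂ →
               ∃ λ y → y ∈ B₂ × y ∉ B₁ × Basis ((B₁ - x) ∪ ⁅ y ⁆)

open Matroid public

Independent : ∀ {n} → Matroid n → Subset n → Set
Independent M S = ∃ λ B → Basis M B × S ⊆ B

Dependent : ∀ {n} → Matroid n → Subset n → Set
Dependent M S = ¬ Independent M S

HasRank : ∀ {n} → Matroid n → ℕ → Set
HasRank M r = ∀ B → Basis M B → ∣ B ∣ ≡ r

allSubsets : (n : ℕ) → List (Subset n)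
allSubsets zero    = [] ∷ []
allSubsets (suc n) = map (inside ∷_) (allSubsets n) ++ map (outside ∷_) (allSubsets n)

-- Polynomials in ℤ[y_c : c ∈ Fin n], represented as formal finite
-- ℤ-linear combinations of monomials (exponent vectors).

Monomial : ℕ → Set
Monomial n = Vec ℕ n

Poly : ℕ → Set
Poly n = List (ℤ × Monomial n)

mono : ∀ {n} → Subset n → Monomial n
mono = Vec.map (λ b → if b then 1 else 0)

_⊕_ : ∀ {n} → Poly n → Poly n → Poly n
p ⊕ q = p ++ q

⊖_ : ∀ {n} → Poly n → Poly n
⊖ p = map (λ t → ℤ.- proj₁ t , proj₂ t) p

_⊝_ : ∀ {n} → Poly n → Poly n → Poly n
p ⊝ q = p ⊕ (⊖ q)

_⊗_ : ∀ {n} → Poly n → Poly n → Poly n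
p ⊗ q = concatMap (λ s → map (λ t → proj₁ s ℤ.* proj₁ t , zipWith Data.Nat._+_ (proj₂ s) (proj₂ t)) q) p
  where import Data.Nat

infixl 6 _⊕_ _⊝_
infixl 7 _⊗_

coeff : ∀ {n} → Poly n → Monomial n → ℤ
coeff []            α = ℤ.0ℤ
coeff ((c , m) ∷ p) α with ≡-dec ℕP._≟_ m α
... | yes _ = c ℤ.+ coeff p α
... | no  _ = coeff p α

-- M_I^J = { B \ I : B basis, I ⊆ B ⊆ E \ J }  and  M_I^J(y) = Σ y^A.

Disjoint? : ∀ {n} (J B : Subset n) → Dec (B ∩ J ≡ ⊥)
Disjoint? J B = ≡-dec BP._≟_ (B ∩ J) ⊥

basesFor : ∀ {n} → Matroid n → (I J : Subset n) → List (Subset n)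
basesFor {n} M I J =
  filter (λ B → basis? M B ×-dec ((I ⊆? B) ×-dec Disjoint? J B)) (allSubsets n)

𝓜 : ∀ {n} → Matroid n → (I J : Subset n) → List (Subset n)
𝓜 M I J = map (λ B → B ─ I) (basesFor M I J)

Mpoly : ∀ {n} → Matroid n → (I J : Subset n) → Poly n
Mpoly M I J = map (λ A → ℤ.1ℤ , mono A) (𝓜 M I J)

ΔM : ∀ {n} → Matroid n → Fin n → Fin n → Poly n
ΔM M e f = Mpoly M ⁅ e ⁆ ⁅ f ⁆ ⊗ Mpoly M ⁅ f ⁆ ⁅ e ⁆
         ⊝ Mpoly M (⁅ e ⁆ ∪ ⁅ f ⁆) ⊥ ⊗ Mpoly M ⊥ (⁅ e ⁆ ∪ ⁅ f ⁆)

ΔMᵍ : ∀ {n} → Matroid n → Fin n → Fin n → Fin n → Poly n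
ΔMᵍ M g e f = Mpoly M ⁅ e ⁆ (⁅ f ⁆ ∪ ⁅ g ⁆) ⊗ Mpoly M ⁅ f ⁆ (⁅ e ⁆ ∪ ⁅ g ⁆)
            ⊝ Mpoly M (⁅ e ⁆ ∪ ⁅ f ⁆) ⁅ g ⁆ ⊗ Mpoly M ⊥ (⁅ e ⁆ ∪ ⁅ f ⁆ ∪ ⁅ g ⁆)

-- Count y^α in a product M_I^J M_K^L by the pairs of bases (B₁, B₂) producing it. A pair counted in
-- M_e^f M_f^e or in M_ef M^ef is counted in the corresponding product with g forbidden exactly when it
-- avoids g, so the coefficient of ΔM{e,f} − ΔM^g{e,f} is the number of mixed pairs (e ∈ B₁ ∌ f,
-- f ∈ B₂ ∌ e) meeting g minus the number of joint pairs (e, f ∈ B₁ and e, f ∉ B₂) meeting g.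
-- In a joint pair g ∉ B₁, as {e,f,g} is dependent, so g ∈ B₂. Writing B₁ = {e,f,x}, a symmetric
-- exchange of g against an element of B₁ cannot use x, since B₁ − x + g = {e,f,g}; so it trades g
-- for e or for f, which turns the joint pair into a mixed pair with the same monomial, injectively.
-- In rank three the symmetric exchange follows from the basis exchange axiom by a case analysis on
-- the bases {e,f,x} and {g,a,b}.

module Submission where

open import Defs
open import Data.Bool using (true; false; _∨_; _∧_; not; if_then_else_)
open import Data.Bool.Properties using (∧-zeroʳ; ∧-identityʳ)
open import Data.Empty using (⊥-elim)
open import Function using (_∘_; case_of_)
open import Data.Fin using (Fin; zero; suc)
open import Data.Fin.Properties using (_≟_)
open import Data.Fin.Subset using (Subset; _∈_; _∉_; _⊆_; _∩_; _∪_; _─_; _-_; ⁅_⁆; ∣_∣; ⊥; inside; outside; Nonempty)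
open import Data.Fin.Subset.Properties
  using (_∈?_; _⊆?_; x∈⁅x⁆; x∈⁅y⁆⇒x≡y; x∈p∪q⁺; x∈p∪q⁻; x∈p∩q⁺; x∈p∩q⁻; x∈p∧x≢y⇒x∈p-y; ∉⊥; Empty-unique;
         p⊆p∪q; q⊆p∪q; ⊥⊆; p─q⊆p; p─⊥≡p; ⊆-antisym; ∪-assoc; ∪-comm; ∪-idem; ∣⁅x⁆∣≡1; ∣p∣≤∣x∷p∣)
open import Data.Nat using (ℕ; zero; suc; _+_; z≤n; s≤s)
import Data.Nat as ℕ
import Data.Nat.Properties as ℕ
open import Algebra.Properties.CommutativeSemigroup ℕ.+-commutativeSemigroup using () renaming (interchange to +-interchange)
open import Data.List using (List; []; _∷_; _++_; map; filter; cartesianProduct)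
open import Relation.Unary using (Decidable)
open import Relation.Nullary.Decidable using (_×-dec_; _⊎-dec_)
import Data.Integer as ℤ
open import Data.Integer using (_≤_; 0ℤ)
import Data.Integer.Properties as ℤ
open import Data.Integer.Solver using (module +-*-Solver)
open import Data.List.Membership.Propositional using () renaming (_∈_ to _∈ₗ_)
open import Data.List.Membership.Propositional.Properties
  using (∈-cartesianProduct⁺; ∈-∃++; ∈-++⁻; ∈-++⁺ˡ; ∈-++⁺ʳ; ∈-map⁺; ∈-map⁻)
open import Data.List.Relation.Unary.Any using () renaming (here to hereₗ; there to thereₗ)
open import Data.List.Relation.Unary.All as All using ([]; _∷_)
open import Data.List.Relation.Unary.AllPairs using ([]; _∷_)
open import Data.List.Relation.Unary.Unique.Propositional using (Unique)
import Data.List.Relation.Unary.Unique.Propositional.Properties as Unique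
open import Data.Product using (∃; _×_; _,_; proj₁; proj₂)
open import Data.Sum using (_⊎_; inj₁; inj₂)
open import Data.Vec using (Vec; []; _∷_; here; there; lookup; zipWith)
open import Data.Vec.Properties
  using (≡-dec; ∷-injectiveʳ; zipWith-comm; tabulate∘lookup; tabulate-cong; lookup-zipWith; lookup-map;
         []=⇒lookup; lookup⇒[]=)
open import Relation.Nullary using (¬_; Dec; yes; no; does)
open import Relation.Binary.PropositionalEquality using (module ≡-Reasoning; _≡_; _≢_; ≢-sym; refl; sym; trans; cong; cong₂; subst)

private variable
  A B : Set
  n k : ℕ
  p q : Subset n
  a b e f g x y z : Fin n

x∉p-x : ∀ (p : Subset n) x → x ∉ p - x
x∉p-x (s ∷ p) zero    ()
x∉p-x (s ∷ p) (suc x) (there x∈p-x) = x∉p-x p x x∈p-x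

x∈p-y⁻ : x ∈ p - y → x ∈ p × x ≢ y
x∈p-y⁻ {p = p} {y} x∈p-y = p─q⊆p p ⁅ y ⁆ x∈p-y , λ { refl → x∉p-x p y x∈p-y }

x∈p-y∪z⁻ : x ∈ (p - y) ∪ ⁅ z ⁆ → (x ∈ p × x ≢ y) ⊎ x ≡ z
x∈p-y∪z⁻ {p = p} {y} {z} x∈ with x∈p∪q⁻ (p - y) ⁅ z ⁆ x∈
... | inj₁ x∈p-y = inj₁ (x∈p-y⁻ x∈p-y)
... | inj₂ x∈⁅z⁆ = inj₂ (x∈⁅y⁆⇒x≡y z x∈⁅z⁆)

y∈p-x∪y : y ∈ (p - x) ∪ ⁅ y ⁆
y∈p-x∪y {y = y} = x∈p∪q⁺ (inj₂ (x∈⁅x⁆ y))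

z∈p-x∪y : z ∈ p → z ≢ x → z ∈ (p - x) ∪ ⁅ y ⁆
z∈p-x∪y z∈p z≢x = x∈p∪q⁺ (inj₁ (x∈p∧x≢y⇒x∈p-y z∈p z≢x))

z∉p-x∪y : z ∉ p → z ≢ y → z ∉ (p - x) ∪ ⁅ y ⁆
z∉p-x∪y z∉p z≢y z∈ with x∈p-y∪z⁻ z∈
... | inj₁ (z∈p , _) = z∉p z∈p
... | inj₂ z≡y      = z≢y z≡y

x∉p-x∪y : x ≢ y → x ∉ (p - x) ∪ ⁅ y ⁆
x∉p-x∪y x≢y x∈ with x∈p-y∪z⁻ x∈
... | inj₁ (_ , x≢x) = x≢x refl
... | inj₂ x≡y       = x≢y x≡y

p-x∪y-injective : x ∈ p → y ∉ p → x ∈ q → y ∉ q → (p - x) ∪ ⁅ y ⁆ ≡ (q - x) ∪ ⁅ y ⁆ → p ≡ q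
p-x∪y-injective x∈p y∉p x∈q y∉q eq = ⊆-antisym (included x∈q eq y∉p) (included x∈p (sym eq) y∉q)
  where
  included : ∀ {p q : Subset n} → x ∈ q → (p - x) ∪ ⁅ y ⁆ ≡ (q - x) ∪ ⁅ y ⁆ → y ∉ p → p ⊆ q
  included {x = x} x∈q eq y∉p {z} z∈p with z ≟ x
  ... | yes refl = x∈q
  ... | no z≢x with x∈p-y∪z⁻ (subst (z ∈_) eq (z∈p-x∪y z∈p z≢x))
  ...   | inj₁ (z∈q , _) = z∈q
  ...   | inj₂ refl      = ⊥-elim (y∉p z∈p)

x∈p⇒⁅x⁆⊆p : x ∈ p → ⁅ x ⁆ ⊆ p
x∈p⇒⁅x⁆⊆p {x = x} {p} x∈p y∈⁅x⁆ = subst (_∈ p) (sym (x∈⁅y⁆⇒x≡y x y∈⁅x⁆)) x∈p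

∩≡⊥⇒∉ : p ∩ q ≡ ⊥ → x ∈ q → x ∉ p
∩≡⊥⇒∉ {p = p} {q} p∩q≡⊥ x∈q x∈p = ∉⊥ (subst (_ ∈_) p∩q≡⊥ (x∈p∩q⁺ (x∈p , x∈q)))

∉⇒∩≡⊥ : (∀ {x} → x ∈ q → x ∉ p) → p ∩ q ≡ ⊥
∉⇒∩≡⊥ {q = q} {p = p} disjoint = Empty-unique λ (x , x∈p∩q) →
  let x∈p , x∈q = x∈p∩q⁻ p q x∈p∩q in disjoint x∈q x∈p

∩≡⊥-antitone : ∀ {r} → q ⊆ r → p ∩ r ≡ ⊥ → p ∩ q ≡ ⊥
∩≡⊥-antitone q⊆r p∩r≡⊥ = ∉⇒∩≡⊥ (∩≡⊥⇒∉ p∩r≡⊥ ∘ q⊆r)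

∉⇒∩⁅x⁆≡⊥ : x ∉ p → p ∩ ⁅ x ⁆ ≡ ⊥
∉⇒∩⁅x⁆≡⊥ {x = x} x∉p = ∉⇒∩≡⊥ λ y∈⁅x⁆ → subst (_∉ _) (sym (x∈⁅y⁆⇒x≡y x y∈⁅x⁆)) x∉p

∩-∪≡⊥ : ∀ {r} → p ∩ q ≡ ⊥ → p ∩ r ≡ ⊥ → p ∩ (q ∪ r) ≡ ⊥
∩-∪≡⊥ {q = q} {r = r} p∩q≡⊥ p∩r≡⊥ = ∉⇒∩≡⊥ λ x∈q∪r → case x∈p∪q⁻ q r x∈q∪r of λ where
  (inj₁ x∈q) → ∩≡⊥⇒∉ p∩q≡⊥ x∈q
  (inj₂ x∈r) → ∩≡⊥⇒∉ p∩r≡⊥ x∈r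

∣p∣≡1+∣p-x∣ : x ∈ p → ∣ p ∣ ≡ suc ∣ p - x ∣
∣p∣≡1+∣p-x∣ {p = inside ∷ p} here        = cong (suc ∘ ∣_∣) (sym (p─⊥≡p p))
∣p∣≡1+∣p-x∣ {p = inside ∷ p} (there x∈p) = cong suc (∣p∣≡1+∣p-x∣ x∈p)
∣p∣≡1+∣p-x∣ {p = outside ∷ p} (there x∈p) = ∣p∣≡1+∣p-x∣ x∈p

∣p∣≡0⇒p≡⊥ : ∣ p ∣ ≡ 0 → p ≡ ⊥
∣p∣≡0⇒p≡⊥ {p = []}          _   = refl
∣p∣≡0⇒p≡⊥ {p = outside ∷ p} ∣p∣≡0 = cong (outside ∷_) (∣p∣≡0⇒p≡⊥ ∣p∣≡0)

∣p∣≡1⇒p≡⁅x⁆ : ∣ p ∣ ≡ 1 → ∃ λ x → p ≡ ⁅ x ⁆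
∣p∣≡1⇒p≡⁅x⁆ {p = inside ∷ p}  ∣p∣≡1 = zero , cong (inside ∷_) (∣p∣≡0⇒p≡⊥ (ℕ.suc-injective ∣p∣≡1))
∣p∣≡1⇒p≡⁅x⁆ {p = outside ∷ p} ∣p∣≡1 with ∣p∣≡1⇒p≡⁅x⁆ ∣p∣≡1
... | x , p≡⁅x⁆ = suc x , cong (outside ∷_) p≡⁅x⁆

∣p∣≡1+k⇒Nonempty : ∣ p ∣ ≡ suc k → Nonempty p
∣p∣≡1+k⇒Nonempty {p = inside ∷ p}  _ = zero , here
∣p∣≡1+k⇒Nonempty {p = outside ∷ p} ∣p∣≡1+k with ∣p∣≡1+k⇒Nonempty ∣p∣≡1+k
... | x , x∈p = suc x , there x∈p

∣p∪q∣≤∣p∣+∣q∣ : ∀ (p q : Subset n) → ∣ p ∪ q ∣ ℕ.≤ ∣ p ∣ + ∣ q ∣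
∣p∪q∣≤∣p∣+∣q∣ []            []      = z≤n
∣p∪q∣≤∣p∣+∣q∣ (inside ∷ p)  (s ∷ q) =
  s≤s (ℕ.≤-trans (∣p∪q∣≤∣p∣+∣q∣ p q) (ℕ.+-monoʳ-≤ ∣ p ∣ (∣p∣≤∣x∷p∣ s q)))
∣p∪q∣≤∣p∣+∣q∣ (outside ∷ p) (inside ∷ q) =
  subst (suc ∣ p ∪ q ∣ ℕ.≤_) (sym (ℕ.+-suc ∣ p ∣ ∣ q ∣)) (s≤s (∣p∪q∣≤∣p∣+∣q∣ p q))
∣p∪q∣≤∣p∣+∣q∣ (outside ∷ p) (outside ∷ q) = ∣p∪q∣≤∣p∣+∣q∣ p q

triple : Fin n → Fin n → Fin n → Subset n
triple x y z = ⁅ x ⁆ ∪ ⁅ y ⁆ ∪ ⁅ z ⁆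

x∈triple : x ∈ triple x y z
x∈triple {x = x} = x∈p∪q⁺ (inj₁ (x∈⁅x⁆ x))

y∈triple : y ∈ triple x y z
y∈triple {y = y} = x∈p∪q⁺ (inj₂ (x∈p∪q⁺ (inj₁ (x∈⁅x⁆ y))))

z∈triple : z ∈ triple x y z
z∈triple {z = z} = x∈p∪q⁺ (inj₂ (x∈p∪q⁺ (inj₂ (x∈⁅x⁆ z))))

∈-triple⁻ : ∀ {w} → w ∈ triple x y z → w ≡ x ⊎ w ≡ y ⊎ w ≡ z
∈-triple⁻ {x = x} {y} {z} w∈ with x∈p∪q⁻ ⁅ x ⁆ _ w∈
... | inj₁ w∈⁅x⁆ = inj₁ (x∈⁅y⁆⇒x≡y x w∈⁅x⁆)
... | inj₂ w∈⁅y,z⁆ with x∈p∪q⁻ ⁅ y ⁆ ⁅ z ⁆ w∈⁅y,z⁆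
...   | inj₁ w∈⁅y⁆ = inj₂ (inj₁ (x∈⁅y⁆⇒x≡y y w∈⁅y⁆))
...   | inj₂ w∈⁅z⁆ = inj₂ (inj₂ (x∈⁅y⁆⇒x≡y z w∈⁅z⁆))

∉-triple : ∀ {w} → w ≢ x → w ≢ y → w ≢ z → w ∉ triple x y z
∉-triple w≢x w≢y w≢z w∈ with ∈-triple⁻ w∈
... | inj₁ w≡x        = w≢x w≡x
... | inj₂ (inj₁ w≡y) = w≢y w≡y
... | inj₂ (inj₂ w≡z) = w≢z w≡z

∉-triple⁻ : ∀ {w} → w ∉ triple x y z → w ≢ x × w ≢ y × w ≢ z
∉-triple⁻ w∉ = (λ { refl → w∉ x∈triple }) , (λ { refl → w∉ y∈triple }) , (λ { refl → w∉ z∈triple })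

triple-swap₁₂ : triple x y z ≡ triple y x z
triple-swap₁₂ {x = x} {y} {z} =
  trans (sym (∪-assoc ⁅ x ⁆ ⁅ y ⁆ ⁅ z ⁆))
        (trans (cong (_∪ ⁅ z ⁆) (∪-comm ⁅ x ⁆ ⁅ y ⁆)) (∪-assoc ⁅ y ⁆ ⁅ x ⁆ ⁅ z ⁆))

triple-swap₂₃ : triple x y z ≡ triple x z y
triple-swap₂₃ {x = x} {y} {z} = cong (⁅ x ⁆ ∪_) (∪-comm ⁅ y ⁆ ⁅ z ⁆)

∉-triple-swap₂₃ : ∀ {w} → w ∉ triple x y z → w ∉ triple x z y
∉-triple-swap₂₃ {w = w} = subst (λ s → w ∉ s) triple-swap₂₃

triple-exchange : ∀ {w} → x ≢ y → x ≢ z → w ≢ x → (triple x y z - x) ∪ ⁅ w ⁆ ≡ triple y z w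
triple-exchange {x = x} {y} {z} {w} x≢y x≢z w≢x = ⊆-antisym ⊆-left ⊆-right
  where
  ⊆-left : (triple x y z - x) ∪ ⁅ w ⁆ ⊆ triple y z w
  ⊆-left v∈ with x∈p-y∪z⁻ v∈
  ... | inj₂ refl = z∈triple
  ... | inj₁ (v∈xyz , v≢x) with ∈-triple⁻ v∈xyz
  ...   | inj₁ v≡x        = ⊥-elim (v≢x v≡x)
  ...   | inj₂ (inj₁ refl) = x∈triple
  ...   | inj₂ (inj₂ refl) = y∈triple
  ⊆-right : triple y z w ⊆ (triple x y z - x) ∪ ⁅ w ⁆
  ⊆-right v∈ with ∈-triple⁻ v∈
  ... | inj₁ refl        = z∈p-x∪y y∈triple (≢-sym x≢y)
  ... | inj₂ (inj₁ refl) = z∈p-x∪y z∈triple (≢-sym x≢z)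
  ... | inj₂ (inj₂ refl) = y∈p-x∪y

∣p∣≡3⇒triple : ∣ p ∣ ≡ 3 → x ∈ p → y ∈ p → x ≢ y → ∃ λ z → z ≢ x × z ≢ y × p ≡ triple x y z
∣p∣≡3⇒triple {p = p} {x} {y} ∣p∣≡3 x∈p y∈p x≢y with ∣p∣≡1⇒p≡⁅x⁆ ∣p-x-y∣≡1
  where
  y∈p-x = x∈p∧x≢y⇒x∈p-y y∈p (≢-sym x≢y)
  ∣p-x-y∣≡1 : ∣ p - x - y ∣ ≡ 1
  ∣p-x-y∣≡1 = ℕ.suc-injective (ℕ.suc-injective
    (trans (sym (trans (∣p∣≡1+∣p-x∣ x∈p) (cong suc (∣p∣≡1+∣p-x∣ y∈p-x)))) ∣p∣≡3))
... | z , p-x-y≡⁅z⁆ = z , z≢x , z≢y , ⊆-antisym ⊆-left ⊆-right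
  where
  z∈p-x-y : z ∈ p - x - y
  z∈p-x-y = subst (z ∈_) (sym p-x-y≡⁅z⁆) (x∈⁅x⁆ z)
  z∈p-x = proj₁ (x∈p-y⁻ z∈p-x-y)
  z≢y   = proj₂ (x∈p-y⁻ z∈p-x-y)
  z∈p   = proj₁ (x∈p-y⁻ z∈p-x)
  z≢x   = proj₂ (x∈p-y⁻ z∈p-x)
  ⊆-left : p ⊆ triple x y z
  ⊆-left {w} w∈p with w ≟ x | w ≟ y
  ... | yes refl | _        = x∈triple
  ... | no _     | yes refl = y∈triple
  ... | no w≢x   | no w≢y   = subst (_∈ triple x y z) (sym w≡z) z∈triple
    where w≡z = x∈⁅y⁆⇒x≡y z (subst (w ∈_) p-x-y≡⁅z⁆ (x∈p∧x≢y⇒x∈p-y (x∈p∧x≢y⇒x∈p-y w∈p w≢x) w≢y))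
  ⊆-right : triple x y z ⊆ p
  ⊆-right w∈ with ∈-triple⁻ w∈
  ... | inj₁ refl        = x∈p
  ... | inj₂ (inj₁ refl) = y∈p
  ... | inj₂ (inj₂ refl) = z∈p

-- Basis exchange in rank three

module _ (M : Matroid n) (rank₃ : HasRank M 3) where

  Basis₃ : Fin n → Fin n → Fin n → Set
  Basis₃ x y z = Basis M (triple x y z)

  basis₃-213 : Basis₃ x y z → Basis₃ y x z
  basis₃-213 = subst (Basis M) triple-swap₁₂

  basis₃-132 : Basis₃ x y z → Basis₃ x z y
  basis₃-132 = subst (Basis M) triple-swap₂₃

  basis₃-231 : Basis₃ x y z → Basis₃ y z x
  basis₃-231 = basis₃-132 ∘ basis₃-213

  basis₃-312 : Basis₃ x y z → Basis₃ z x y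
  basis₃-312 = basis₃-213 ∘ basis₃-132

  basis₃-321 : Basis₃ x y z → Basis₃ z y x
  basis₃-321 = basis₃-213 ∘ basis₃-231

  ¬Basis₃-xxz : ¬ Basis₃ x x z
  ¬Basis₃-xxz {x = x} {z} H = ℕ.<-irrefl refl (begin
    3                     ≡⟨ rank₃ _ H ⟨
    ∣ triple x x z ∣      ≡⟨ cong ∣_∣ (trans (sym (∪-assoc ⁅ x ⁆ ⁅ x ⁆ ⁅ z ⁆)) (cong (_∪ ⁅ z ⁆) (∪-idem ⁅ x ⁆))) ⟩
    ∣ ⁅ x ⁆ ∪ ⁅ z ⁆ ∣     ≤⟨ ∣p∪q∣≤∣p∣+∣q∣ ⁅ x ⁆ ⁅ z ⁆ ⟩
    ∣ ⁅ x ⁆ ∣ + ∣ ⁅ z ⁆ ∣ ≡⟨ cong₂ _+_ (∣⁅x⁆∣≡1 x) (∣⁅x⁆∣≡1 z) ⟩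
    2                     ∎)
    where open ℕ.≤-Reasoning

  basis₃-distinct : Basis₃ x y z → x ≢ y × x ≢ z × y ≢ z
  basis₃-distinct H = (λ { refl → ¬Basis₃-xxz H })
                    , (λ { refl → ¬Basis₃-xxz (basis₃-132 H) })
                    , (λ { refl → ¬Basis₃-xxz (basis₃-231 H) })

  basis₃-exchange : ∀ {p q r s t u} → Basis₃ p q r → Basis₃ s t u → p ∉ triple s t u →
    ∃ λ y → (y ≡ s ⊎ y ≡ t ⊎ y ≡ u) × y ∉ triple p q r × Basis₃ q r y
  basis₃-exchange Hpqr Hstu p∉stu with exchange M Hpqr Hstu x∈triple p∉stu
  ... | y , y∈stu , y∉pqr , H = y , ∈-triple⁻ y∈stu , y∉pqr ,
        subst (Basis M) (triple-exchange p≢q p≢r (proj₁ (∉-triple⁻ y∉pqr))) H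
    where
    p≢q = proj₁ (basis₃-distinct Hpqr)
    p≢r = proj₁ (proj₂ (basis₃-distinct Hpqr))

  -- Symmetric exchange of g against e or f between the bases {e,f,x} and {g,a,b}.
  Swappable : (e f g x a b : Fin n) → Set
  Swappable e f g x a b = (Basis₃ f x g × Basis₃ a b e) ⊎ (Basis₃ e x g × Basis₃ a b f)

  swappable-swap : Swappable e f g x b a → Swappable e f g x a b
  swappable-swap (inj₁ (Hfxg , Hbae)) = inj₁ (Hfxg , basis₃-213 Hbae)
  swappable-swap (inj₂ (Hexg , Hbaf)) = inj₂ (Hexg , basis₃-213 Hbaf)

  basis₃-egx : Basis₃ e f x → ¬ Basis₃ e f g → a ∉ triple e f x → Basis₃ a e g → Basis₃ e g x
  basis₃-egx Hefx ¬Hefg a∉efx Haeg with basis₃-exchange Haeg Hefx a∉efx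
  ... | _ , inj₁ refl , y∉ , _          = ⊥-elim (y∉ y∈triple)
  ... | _ , inj₂ (inj₁ refl) , _ , Hegf = ⊥-elim (¬Hefg (basis₃-132 Hegf))
  ... | _ , inj₂ (inj₂ refl) , _ , Hegx = Hegx

  swappable-via-a-if-aeg : Basis₃ e f x → Basis₃ g a b → ¬ Basis₃ e f g →
                           e ∉ triple g a b → f ∉ triple g a b → a ∉ triple e f x →
                           Basis₃ e f a → Basis₃ a e g → Swappable e f g x a b
  swappable-via-a-if-aeg {e} {f} {x} {g} {a} {b} Hefx Hgab ¬Hefg e∉gab f∉gab a∉efx Hefa Haeg
    with basis₃-exchange (basis₃-132 Hefa) Hgab e∉gab
  ... | _ , inj₁ refl , _ , Hafg      = via-afg Hafg
    where
    g∉aef : g ∉ triple a e f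
    g∉aef = ∉-triple (proj₁ (basis₃-distinct Hgab))
                     (≢-sym (proj₁ (∉-triple⁻ e∉gab))) (≢-sym (proj₁ (∉-triple⁻ f∉gab)))
    via-afg : Basis₃ a f g → Swappable e f g x a b
    via-afg Hafg with basis₃-exchange Hafg Hefx a∉efx | basis₃-exchange Hgab (basis₃-312 Hefa) g∉aef
    ... | _ , inj₁ refl , _ , Hfge        | _ = ⊥-elim (¬Hefg (basis₃-312 Hfge))
    ... | _ , inj₂ (inj₁ refl) , y∉ , _   | _ = ⊥-elim (y∉ y∈triple)
    ... | _ , inj₂ (inj₂ refl) , _ , _    | _ , inj₁ refl , z∉ , _ = ⊥-elim (z∉ y∈triple)
    ... | _ , inj₂ (inj₂ refl) , _ , Hfgx | _ , inj₂ (inj₁ refl) , _ , Habe = inj₁ (basis₃-132 Hfgx , Habe)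
    ... | _ , inj₂ (inj₂ refl) , _ , _    | _ , inj₂ (inj₂ refl) , _ , Habf =
      inj₂ (basis₃-132 (basis₃-egx Hefx ¬Hefg a∉efx Haeg) , Habf)
  ... | _ , inj₂ (inj₁ refl) , y∉ , _ = ⊥-elim (y∉ y∈triple)
  ... | _ , inj₂ (inj₂ refl) , _ , Hafb = inj₂ (basis₃-132 (basis₃-egx Hefx ¬Hefg a∉efx Haeg) , basis₃-132 Hafb)

  swappable-via-a-if-¬aeg : Basis₃ e f x → Basis₃ g a b → ¬ Basis₃ e f g →
                            e ∉ triple g a b → f ∉ triple g a b → a ∉ triple e f x →
                            Basis₃ e f a → ¬ Basis₃ a e g → Swappable e f g x a b
  swappable-via-a-if-¬aeg {e} {f} {x} {g} {a} {b} Hefx Hgab ¬Hefg e∉gab f∉gab a∉efx Hefa ¬Haeg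
    with basis₃-exchange (basis₃-213 Hgaf) Hefx a∉efx
    where
    b∉aef : b ∉ triple a e f
    b∉aef = ∉-triple (≢-sym (proj₂ (proj₂ (basis₃-distinct Hgab))))
                     (≢-sym (proj₂ (proj₂ (∉-triple⁻ e∉gab)))) (≢-sym (proj₂ (proj₂ (∉-triple⁻ f∉gab))))
    Hgaf : Basis₃ g a f
    Hgaf with basis₃-exchange (basis₃-312 Hgab) (basis₃-312 Hefa) b∉aef
    ... | _ , inj₁ refl , y∉ , _          = ⊥-elim (y∉ z∈triple)
    ... | _ , inj₂ (inj₁ refl) , _ , Hgae = ⊥-elim (¬Haeg (basis₃-231 Hgae))
    ... | _ , inj₂ (inj₂ refl) , _ , Hgaf = Hgaf
  ... | _ , inj₁ refl , _ , Hgfe        = ⊥-elim (¬Hefg (basis₃-321 Hgfe))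
  ... | _ , inj₂ (inj₁ refl) , y∉ , _   = ⊥-elim (y∉ z∈triple)
  ... | _ , inj₂ (inj₂ refl) , _ , Hgfx = inj₁ (basis₃-231 Hgfx , basis₃-132 Haeb)
    where
    Haeb : Basis₃ a e b
    Haeb with basis₃-exchange (basis₃-132 (basis₃-213 Hefa)) Hgab f∉gab
    ... | _ , inj₁ refl , _ , Haeg        = ⊥-elim (¬Haeg Haeg)
    ... | _ , inj₂ (inj₁ refl) , y∉ , _   = ⊥-elim (y∉ y∈triple)
    ... | _ , inj₂ (inj₂ refl) , _ , Haeb = Haeb

  swappable-via-a : Basis₃ e f x → Basis₃ g a b → ¬ Basis₃ e f g →
                    e ∉ triple g a b → f ∉ triple g a b → a ∉ triple e f x →
                    Basis₃ e f a → Swappable e f g x a b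
  swappable-via-a {e} {f} {x} {g} {a} {b} Hefx Hgab ¬Hefg e∉gab f∉gab a∉efx Hefa with basis? M (triple a e g)
  ... | yes Haeg = swappable-via-a-if-aeg Hefx Hgab ¬Hefg e∉gab f∉gab a∉efx Hefa Haeg
  ... | no ¬Haeg = swappable-via-a-if-¬aeg Hefx Hgab ¬Hefg e∉gab f∉gab a∉efx Hefa ¬Haeg

  swappable-disjoint : Basis₃ e f x → Basis₃ g a b → ¬ Basis₃ e f g →
                       e ∉ triple g a b → f ∉ triple g a b → x ∉ triple g a b →
                       Swappable e f g x a b
  swappable-disjoint Hefx Hgab ¬Hefg e∉gab f∉gab x∉gab
    with basis₃-exchange (basis₃-312 Hefx) Hgab x∉gab
  ... | _ , inj₁ refl , _ , Hefg = ⊥-elim (¬Hefg Hefg)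
  ... | _ , inj₂ (inj₁ refl) , _ , Hefa =
    swappable-via-a Hefx Hgab ¬Hefg e∉gab f∉gab (∉-triple a≢e a≢f a≢x) Hefa
    where
    a≢e = ≢-sym (proj₁ (proj₂ (∉-triple⁻ e∉gab)))
    a≢f = ≢-sym (proj₁ (proj₂ (∉-triple⁻ f∉gab)))
    a≢x = ≢-sym (proj₁ (proj₂ (∉-triple⁻ x∉gab)))
  ... | _ , inj₂ (inj₂ refl) , _ , Hefb = swappable-swap
    (swappable-via-a Hefx (basis₃-132 Hgab) ¬Hefg (∉-triple-swap₂₃ e∉gab) (∉-triple-swap₂₃ f∉gab)
                     (∉-triple b≢e b≢f b≢x) Hefb)
    where
    b≢e = ≢-sym (proj₂ (proj₂ (∉-triple⁻ e∉gab)))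
    b≢f = ≢-sym (proj₂ (proj₂ (∉-triple⁻ f∉gab)))
    b≢x = ≢-sym (proj₂ (proj₂ (∉-triple⁻ x∉gab)))

  swappable-shared : Basis₃ e f x → Basis₃ g x b → ¬ Basis₃ e f g →
                     e ∉ triple g x b → f ∉ triple g x b → Swappable e f g x x b
  swappable-shared {e} {f} {x} {g} {b} Hefx Hgxb ¬Hefg e∉gxb f∉gxb with basis? M (triple e g x)
  ... | yes Hegx = via-fxg-or-fxb
    where
    g∉efx : g ∉ triple e f x
    g∉efx = ∉-triple (≢-sym (proj₁ (∉-triple⁻ e∉gxb))) (≢-sym (proj₁ (∉-triple⁻ f∉gxb)))
                     (proj₁ (basis₃-distinct Hgxb))
    via-fxg : Basis₃ f x g → Swappable e f g x x b
    via-fxg Hfxg with basis₃-exchange Hgxb Hefx g∉efx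
    ... | _ , inj₁ refl , _ , Hxbe        = inj₁ (Hfxg , Hxbe)
    ... | _ , inj₂ (inj₁ refl) , _ , Hxbf = inj₂ (basis₃-132 Hegx , Hxbf)
    ... | _ , inj₂ (inj₂ refl) , z∉ , _   = ⊥-elim (z∉ y∈triple)
    via-fxg-or-fxb : Swappable e f g x x b
    via-fxg-or-fxb with basis₃-exchange Hefx Hgxb e∉gxb
    ... | _ , inj₁ refl , _ , Hfxg        = via-fxg Hfxg
    ... | _ , inj₂ (inj₁ refl) , y∉ , _   = ⊥-elim (y∉ z∈triple)
    ... | _ , inj₂ (inj₂ refl) , _ , Hfxb = inj₂ (basis₃-132 Hegx , basis₃-231 Hfxb)
  ... | no ¬Hegx = via-gxf
    where
    Hexb : Basis₃ e x b
    Hexb with basis₃-exchange (basis₃-213 Hefx) Hgxb f∉gxb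
    ... | _ , inj₁ refl , _ , Hexg        = ⊥-elim (¬Hegx (basis₃-132 Hexg))
    ... | _ , inj₂ (inj₁ refl) , y∉ , _   = ⊥-elim (y∉ z∈triple)
    ... | _ , inj₂ (inj₂ refl) , _ , Hexb = Hexb
    b∉efx : b ∉ triple e f x
    b∉efx = ∉-triple (≢-sym (proj₂ (proj₂ (∉-triple⁻ e∉gxb)))) (≢-sym (proj₂ (proj₂ (∉-triple⁻ f∉gxb))))
                     (≢-sym (proj₂ (proj₂ (basis₃-distinct Hgxb))))
    via-gxf : Swappable e f g x x b
    via-gxf with basis₃-exchange (basis₃-312 Hgxb) Hefx b∉efx
    ... | _ , inj₁ refl , _ , Hgxe        = ⊥-elim (¬Hegx (basis₃-312 Hgxe))
    ... | _ , inj₂ (inj₁ refl) , _ , Hgxf = inj₁ (basis₃-321 Hgxf , basis₃-132 (basis₃-213 Hexb))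
    ... | _ , inj₂ (inj₂ refl) , y∉ , _   = ⊥-elim (y∉ z∈triple)

  swappable : Basis₃ e f x → Basis₃ g a b → ¬ Basis₃ e f g →
              e ∉ triple g a b → f ∉ triple g a b → Swappable e f g x a b
  swappable {e} {f} {x} {g} {a} {b} Hefx Hgab ¬Hefg e∉gab f∉gab with x ≟ a | x ≟ b
  ... | yes refl | _        = swappable-shared Hefx Hgab ¬Hefg e∉gab f∉gab
  ... | no _     | yes refl = swappable-swap
    (swappable-shared Hefx (basis₃-132 Hgab) ¬Hefg (∉-triple-swap₂₃ e∉gab) (∉-triple-swap₂₃ f∉gab))
  ... | no x≢a   | no x≢b   = swappable-disjoint Hefx Hgab ¬Hefg e∉gab f∉gab (∉-triple x≢g x≢a x≢b)
    where
    x≢g : x ≢ g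
    x≢g refl = ¬Hefg Hefx

  basis-exchange-e-or-f : ∀ {B₁ B₂} → ¬ Basis₃ e f g → e ≢ f →
    Basis M B₁ → e ∈ B₁ → f ∈ B₁ → Basis M B₂ → g ∈ B₂ → e ∉ B₂ → f ∉ B₂ →
    (Basis M ((B₁ - e) ∪ ⁅ g ⁆) × Basis M ((B₂ - g) ∪ ⁅ e ⁆)) ⊎
    (Basis M ((B₁ - f) ∪ ⁅ g ⁆) × Basis M ((B₂ - g) ∪ ⁅ f ⁆))
  basis-exchange-e-or-f {e} {f} {g} {B₁} {B₂} ¬Hefg e≢f HB₁ e∈B₁ f∈B₁ HB₂ g∈B₂ e∉B₂ f∉B₂
    with ∣p∣≡1+k⇒Nonempty {p = B₂ - g} (ℕ.suc-injective (trans (sym (∣p∣≡1+∣p-x∣ g∈B₂)) (rank₃ B₂ HB₂)))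
  ... | a , a∈B₂-g
    with x∈p-y⁻ a∈B₂-g
  ... | a∈B₂ , a≢g
    with ∣p∣≡3⇒triple (rank₃ B₁ HB₁) e∈B₁ f∈B₁ e≢f
       | ∣p∣≡3⇒triple (rank₃ B₂ HB₂) g∈B₂ a∈B₂ (≢-sym a≢g)
  ... | x , x≢e , x≢f , refl | b , b≢g , b≢a , refl
    with swappable HB₁ HB₂ ¬Hefg e∉B₂ f∉B₂
  ... | inj₁ (Hfxg , Habe) =
    inj₁ (subst (Basis M) (sym (triple-exchange e≢f (≢-sym x≢e) (≢-sym e≢g))) Hfxg ,
          subst (Basis M) (sym (triple-exchange (≢-sym a≢g) (≢-sym b≢g) e≢g)) Habe)
    where e≢g = proj₁ (∉-triple⁻ e∉B₂)
  ... | inj₂ (Hexg , Habf) =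
    inj₂ (subst (Basis M) (sym (trans (cong (λ s → (s - f) ∪ ⁅ g ⁆) triple-swap₁₂)
                                      (triple-exchange (≢-sym e≢f) (≢-sym x≢f) (≢-sym f≢g)))) Hexg ,
          subst (Basis M) (sym (triple-exchange (≢-sym a≢g) (≢-sym b≢g) f≢g)) Habf)
    where f≢g = proj₁ (∉-triple⁻ f∉B₂)

-- Counting

∑ : List A → (A → ℕ) → ℕ
∑ []       w = 0
∑ (x ∷ xs) w = w x + ∑ xs w

𝟙 : {P : Set} → Dec P → ℕ
𝟙 P? = if does P? then 1 else 0

count : {P : A → Set} → Decidable P → List A → ℕ
count P? xs = ∑ xs (λ x → 𝟙 (P? x))

∑-++ : ∀ (xs ys : List A) w → ∑ (xs ++ ys) w ≡ ∑ xs w + ∑ ys w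
∑-++ []       ys w = refl
∑-++ (x ∷ xs) ys w = trans (cong (w x +_) (∑-++ xs ys w)) (sym (ℕ.+-assoc (w x) _ _))

∑-map : ∀ (h : A → B) xs (w : B → ℕ) → ∑ (map h xs) w ≡ ∑ xs (λ x → w (h x))
∑-map h []       w = refl
∑-map h (x ∷ xs) w = cong (w (h x) +_) (∑-map h xs w)

∑-filter : ∀ {P : A → Set} (P? : Decidable P) xs w →
           ∑ (filter P? xs) w ≡ ∑ xs (λ x → if does (P? x) then w x else 0)
∑-filter P? []       w = refl
∑-filter P? (x ∷ xs) w with does (P? x)
... | true  = cong (w x +_) (∑-filter P? xs w)
... | false = ∑-filter P? xs w

∑-cong : ∀ xs {w v : A → ℕ} → (∀ x → w x ≡ v x) → ∑ xs w ≡ ∑ xs v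
∑-cong []       w≗v = refl
∑-cong (x ∷ xs) w≗v = cong₂ _+_ (w≗v x) (∑-cong xs w≗v)

∑-+ : ∀ xs (w v : A → ℕ) → ∑ xs (λ x → w x + v x) ≡ ∑ xs w + ∑ xs v
∑-+ []       w v = refl
∑-+ (x ∷ xs) w v = trans (cong (w x + v x +_) (∑-+ xs w v)) (+-interchange (w x) (v x) (∑ xs w) (∑ xs v))

∑-cartesianProduct : ∀ (xs : List A) (ys : List B) (w : A × B → ℕ) →
                     ∑ (cartesianProduct xs ys) w ≡ ∑ xs (λ x → ∑ ys (λ y → w (x , y)))
∑-cartesianProduct []       ys w = refl
∑-cartesianProduct (x ∷ xs) ys w =
  trans (∑-++ (map (x ,_) ys) _ w) (cong₂ _+_ (∑-map (x ,_) ys w) (∑-cartesianProduct xs ys w))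

if-∑ : ∀ {X : Set} (X? : Dec X) xs (w : A → ℕ) →
       (if does X? then ∑ xs w else 0) ≡ ∑ xs (λ x → if does X? then w x else 0)
if-∑ (yes _) xs w = refl
if-∑ (no _)  []       w = refl
if-∑ (no ¬x) (x ∷ xs) w = if-∑ (no ¬x) xs w

if-𝟙 : ∀ {X Y : Set} (X? : Dec X) (Y? : Dec Y) → (if does X? then 𝟙 Y? else 0) ≡ 𝟙 (X? ×-dec Y?)
if-𝟙 (yes _) Y? = refl
if-𝟙 (no _)  Y? = refl

count-split : ∀ {P Q R : A → Set} (P? : Decidable P) (Q? : Decidable Q) (R? : Decidable R) xs →
  (∀ {x} → Q x → P x × ¬ R x) → (∀ {x} → P x → ¬ R x → Q x) →
  count P? xs ≡ count Q? xs + count (λ x → P? x ×-dec R? x) xs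
count-split P? Q? R? xs Q⇒P∧¬R P∧¬R⇒Q = trans (∑-cong xs pointwise) (∑-+ xs _ _)
  where
  pointwise : ∀ x → 𝟙 (P? x) ≡ 𝟙 (Q? x) + 𝟙 (P? x ×-dec R? x)
  pointwise x with P? x | Q? x | R? x
  ... | yes _  | yes Qx | yes Rx = ⊥-elim (proj₂ (Q⇒P∧¬R Qx) Rx)
  ... | yes _  | no _   | yes _  = refl
  ... | yes _  | yes _  | no _   = refl
  ... | yes Px | no ¬Qx | no ¬Rx = ⊥-elim (¬Qx (P∧¬R⇒Q Px ¬Rx))
  ... | no ¬Px | yes Qx | _      = ⊥-elim (¬Px (proj₁ (Q⇒P∧¬R Qx)))
  ... | no _   | no _   | _      = refl

count-≤-injection : ∀ {P Q : A → Set} (P? : Decidable P) (Q? : Decidable Q) (φ : A → A) →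
  (∀ {x} → P x → Q (φ x)) → (∀ {x y} → P x → P y → φ x ≡ φ y → x ≡ y) →
  ∀ {xs} → Unique xs → ∀ ys → (∀ {x} → x ∈ₗ xs → P x → φ x ∈ₗ ys) →
  count P? xs ℕ.≤ count Q? ys
count-≤-injection P? Q? φ P⇒Qφ φ-inj {[]} _ ys _ = z≤n
count-≤-injection {P = P} P? Q? φ P⇒Qφ φ-inj {x ∷ xs} (x∉xs ∷ xs-unique) ys φ∈ys with P? x
... | no _  = count-≤-injection P? Q? φ P⇒Qφ φ-inj xs-unique ys (φ∈ys ∘ thereₗ)
... | yes Px with ∈-∃++ (φ∈ys (hereₗ refl) Px)
...   | us , vs , refl = subst (suc (count P? xs) ℕ.≤_) (sym count-us-φx-vs) (s≤s count-xs≤count-us-vs)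
  where
  count-us-φx-vs : count Q? (us ++ φ x ∷ vs) ≡ suc (count Q? (us ++ vs))
  count-us-φx-vs with Q? (φ x) in eq
  ... | yes _ = begin
    count Q? (us ++ φ x ∷ vs)          ≡⟨ ∑-++ us (φ x ∷ vs) _ ⟩
    count Q? us + (𝟙 (Q? (φ x)) + count Q? vs) ≡⟨ cong (λ d → count Q? us + (𝟙 d + count Q? vs)) eq ⟩
    count Q? us + suc (count Q? vs)    ≡⟨ ℕ.+-suc (count Q? us) _ ⟩
    suc (count Q? us + count Q? vs)    ≡⟨ cong suc (∑-++ us vs _) ⟨
    suc (count Q? (us ++ vs))          ∎
    where open ≡-Reasoning
  ... | no ¬Qφx = ⊥-elim (¬Qφx (P⇒Qφ Px))
  φ∈us++vs : ∀ {z} → z ∈ₗ xs → P z → φ z ∈ₗ us ++ vs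
  φ∈us++vs z∈xs Pz with ∈-++⁻ us (φ∈ys (thereₗ z∈xs) Pz)
  ... | inj₁ φz∈us          = ∈-++⁺ˡ φz∈us
  ... | inj₂ (hereₗ φz≡φx)   = ⊥-elim (All.lookup x∉xs z∈xs (sym (φ-inj Pz Px φz≡φx)))
  ... | inj₂ (thereₗ φz∈vs)  = ∈-++⁺ʳ us φz∈vs
  count-xs≤count-us-vs = count-≤-injection P? Q? φ P⇒Qφ φ-inj xs-unique (us ++ vs) φ∈us++vs

∈-allSubsets : ∀ (p : Subset n) → p ∈ₗ allSubsets n
∈-allSubsets []            = hereₗ refl
∈-allSubsets (inside ∷ p)  = ∈-++⁺ˡ (∈-map⁺ (inside ∷_) (∈-allSubsets p))
∈-allSubsets (outside ∷ p) = ∈-++⁺ʳ (map (inside ∷_) (allSubsets _)) (∈-map⁺ (outside ∷_) (∈-allSubsets p))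

allSubsets-unique : ∀ n → Unique (allSubsets n)
allSubsets-unique zero    = [] ∷ []
allSubsets-unique (suc n) =
  Unique.++⁺ (Unique.map⁺ ∷-injectiveʳ (allSubsets-unique n)) (Unique.map⁺ ∷-injectiveʳ (allSubsets-unique n))
             disjoint
  where
  disjoint : ∀ {p} → ¬ (p ∈ₗ map (inside ∷_) (allSubsets n) × p ∈ₗ map (outside ∷_) (allSubsets n))
  disjoint (p∈ins , p∈outs) with ∈-map⁻ (inside ∷_) p∈ins | ∈-map⁻ (outside ∷_) p∈outs
  ... | _ , _ , refl | _ , _ , ()

allPairs : ∀ n → List (Subset n × Subset n)
allPairs n = cartesianProduct (allSubsets n) (allSubsets n)

#pairs : {P : Subset n × Subset n → Set} → Decidable P → ℕ
#pairs P? = count P? (allPairs _)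

-- Coefficients of the basis generating polynomials

infixl 7 _⊙_
infix 4 _≟ᵐ_

_⊙_ : Monomial n → Monomial n → Monomial n
_⊙_ = zipWith _+_

_≟ᵐ_ : (μ ν : Monomial n) → Dec (μ ≡ ν)
_≟ᵐ_ = ≡-dec ℕ._≟_

⊙-comm : ∀ (μ ν : Monomial n) → μ ⊙ ν ≡ ν ⊙ μ
⊙-comm = zipWith-comm ℕ.+-comm

coeff-⊕ : ∀ (P Q : Poly n) α → coeff (P ⊕ Q) α ≡ coeff P α ℤ.+ coeff Q α
coeff-⊕ []            Q α = sym (ℤ.+-identityˡ _)
coeff-⊕ ((c , μ) ∷ P) Q α with μ ≟ᵐ α
... | yes _ = trans (cong (λ z → c ℤ.+ z) (coeff-⊕ P Q α)) (sym (ℤ.+-assoc c _ _))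
... | no _  = coeff-⊕ P Q α

coeff-⊖ : ∀ (P : Poly n) α → coeff (⊖ P) α ≡ ℤ.- coeff P α
coeff-⊖ []            α = refl
coeff-⊖ ((c , μ) ∷ P) α with μ ≟ᵐ α
... | yes _ = trans (cong (λ z → ℤ.- c ℤ.+ z) (coeff-⊖ P α)) (sym (ℤ.neg-distrib-+ c _))
... | no _  = coeff-⊖ P α

coeff-⊝ : ∀ (P Q : Poly n) α → coeff (P ⊝ Q) α ≡ coeff P α ℤ.- coeff Q α
coeff-⊝ P Q α = trans (coeff-⊕ P (⊖ Q) α) (cong (λ z → coeff P α ℤ.+ z) (coeff-⊖ Q α))

generatingPoly : List (Subset n) → Poly n
generatingPoly = map (λ A → ℤ.1ℤ , mono A)

coeff-generatingPoly-⊗ : ∀ (L₁ L₂ : List (Subset n)) α →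
  coeff (generatingPoly L₁ ⊗ generatingPoly L₂) α ≡ ℤ.+ ∑ L₁ (λ A → count (λ B → mono A ⊙ mono B ≟ᵐ α) L₂)
coeff-generatingPoly-⊗ []       L₂ α = refl
coeff-generatingPoly-⊗ (A ∷ L₁) L₂ α =
  trans (coeff-⊕ (map _ (generatingPoly L₂)) (generatingPoly L₁ ⊗ generatingPoly L₂) α)
        (cong₂ ℤ._+_ (coeff-A⊗ L₂) (coeff-generatingPoly-⊗ L₁ L₂ α))
  where
  coeff-A⊗ : ∀ L → coeff (map (λ t → ℤ.1ℤ ℤ.* proj₁ t , mono A ⊙ proj₂ t) (generatingPoly L)) α
                   ≡ ℤ.+ count (λ B → mono A ⊙ mono B ≟ᵐ α) L
  coeff-A⊗ []      = refl
  coeff-A⊗ (B ∷ L) with mono A ⊙ mono B ≟ᵐ α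
  ... | yes _ = cong (λ z → ℤ.1ℤ ℤ.+ z) (coeff-A⊗ L)
  ... | no _  = coeff-A⊗ L

≗-lookup⇒≡ : (u v : Vec A n) → (∀ i → lookup u i ≡ lookup v i) → u ≡ v
≗-lookup⇒≡ u v u≗v = trans (sym (tabulate∘lookup u)) (trans (tabulate-cong u≗v) (tabulate∘lookup v))

lookup-∪ : ∀ (p q : Subset n) i → lookup (p ∪ q) i ≡ lookup p i ∨ lookup q i
lookup-∪ p q i = lookup-zipWith _∨_ i p q

lookup-─ : ∀ (p q : Subset n) i → lookup (p ─ q) i ≡ lookup p i ∧ not (lookup q i)
lookup-─ (s ∷ p) (inside ∷ q)  zero    = sym (∧-zeroʳ s)
lookup-─ (s ∷ p) (outside ∷ q) zero    = sym (∧-identityʳ s)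
lookup-─ (s ∷ p) (t ∷ q)       (suc i) = lookup-─ p q i

lookup-⁅⁆ : ∀ (x i : Fin n) → lookup ⁅ x ⁆ i ≡ does (x ≟ i)
lookup-⁅⁆ x i with x ≟ i | lookup ⁅ x ⁆ i in eq
... | yes refl | true  = refl
... | yes refl | false = trans (sym eq) ([]=⇒lookup (x∈⁅x⁆ x))
... | no x≢i   | true  = ⊥-elim (x≢i (sym (x∈⁅y⁆⇒x≡y x (lookup⇒[]= i ⁅ x ⁆ eq))))
... | no _     | false = refl

lookup-∉ : x ∉ p → lookup p x ≡ false
lookup-∉ {x = x} {p} x∉p with lookup p x in eq
... | true  = ⊥-elim (x∉p (lookup⇒[]= x p eq))
... | false = refl

lookup-⊙-mono : ∀ (A B : Subset n) i →
                lookup (mono A ⊙ mono B) i ≡ (if lookup A i then 1 else 0) + (if lookup B i then 1 else 0)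
lookup-⊙-mono A B i = trans (lookup-zipWith _+_ i (mono A) (mono B)) (cong₂ _+_ (lookup-map i _ A) (lookup-map i _ B))

mono-exchange : ∀ {B₁ B₂ : Subset n} → g ∉ B₁ → g ∈ B₂ → x ∉ B₂ → x ≢ g → y ≢ g →
  mono (((B₁ - x) ∪ ⁅ g ⁆) - y) ⊙ mono (((B₂ - g) ∪ ⁅ x ⁆) - x) ≡ mono (B₁ ─ (⁅ x ⁆ ∪ ⁅ y ⁆)) ⊙ mono B₂
mono-exchange {g = g} {x = x} {y = y} {B₁ = B₁} {B₂ = B₂} g∉B₁ g∈B₂ x∉B₂ x≢g y≢g = ≗-lookup⇒≡ _ _ pointwise
  where
  pointwise : ∀ i → lookup (mono (((B₁ - x) ∪ ⁅ g ⁆) - y) ⊙ mono (((B₂ - g) ∪ ⁅ x ⁆) - x)) i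
                  ≡ lookup (mono (B₁ ─ (⁅ x ⁆ ∪ ⁅ y ⁆)) ⊙ mono B₂) i
  pointwise i
    rewrite lookup-⊙-mono (((B₁ - x) ∪ ⁅ g ⁆) - y) (((B₂ - g) ∪ ⁅ x ⁆) - x) i
          | lookup-⊙-mono (B₁ ─ (⁅ x ⁆ ∪ ⁅ y ⁆)) B₂ i
          | lookup-─ ((B₁ - x) ∪ ⁅ g ⁆) ⁅ y ⁆ i | lookup-─ ((B₂ - g) ∪ ⁅ x ⁆) ⁅ x ⁆ i
          | lookup-∪ (B₁ - x) ⁅ g ⁆ i | lookup-∪ (B₂ - g) ⁅ x ⁆ i
          | lookup-─ B₁ ⁅ x ⁆ i | lookup-─ B₂ ⁅ g ⁆ i | lookup-─ B₁ (⁅ x ⁆ ∪ ⁅ y ⁆) i | lookup-∪ ⁅ x ⁆ ⁅ y ⁆ i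
          | lookup-⁅⁆ x i | lookup-⁅⁆ y i | lookup-⁅⁆ g i
    with g ≟ i | x ≟ i | y ≟ i
  ... | yes refl | yes refl | _        = ⊥-elim (x≢g refl)
  ... | yes refl | no _     | yes refl = ⊥-elim (y≢g refl)
  ... | yes refl | no _     | no _     rewrite lookup-∉ g∉B₁ | []=⇒lookup g∈B₂ = refl
  ... | no _     | yes refl | _        rewrite lookup-∉ x∉B₂ with lookup B₁ x
  ...   | true  = refl
  ...   | false = refl
  pointwise i | no _ | no _ | yes refl with lookup B₁ y | lookup B₂ y
  ...   | true  | true  = refl
  ...   | true  | false = refl
  ...   | false | true  = refl
  ...   | false | false = refl
  pointwise i | no _ | no _ | no _ with lookup B₁ i | lookup B₂ i
  ...   | true  | true  = refl
  ...   | true  | false = refl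
  ...   | false | true  = refl
  ...   | false | false = refl

module _ (M : Matroid n) (α : Monomial n) where

  Fits : (I J B : Subset n) → Set
  Fits I J B = Basis M B × (I ⊆ B × B ∩ J ≡ ⊥)

  fits? : ∀ I J → Decidable (Fits I J)
  fits? I J B = basis? M B ×-dec ((I ⊆? B) ×-dec Disjoint? J B)

  Contributes : (I₁ J₁ I₂ J₂ : Subset n) → Subset n × Subset n → Set
  Contributes I₁ J₁ I₂ J₂ (B₁ , B₂) = Fits I₁ J₁ B₁ × (Fits I₂ J₂ B₂ × mono (B₁ ─ I₁) ⊙ mono (B₂ ─ I₂) ≡ α)

  contributes? : ∀ I₁ J₁ I₂ J₂ → Decidable (Contributes I₁ J₁ I₂ J₂)
  contributes? I₁ J₁ I₂ J₂ (B₁ , B₂) =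
    fits? I₁ J₁ B₁ ×-dec (fits? I₂ J₂ B₂ ×-dec mono (B₁ ─ I₁) ⊙ mono (B₂ ─ I₂) ≟ᵐ α)

  ∑-𝓜 : ∀ I J w → ∑ (𝓜 M I J) w ≡ ∑ (allSubsets n) (λ B → if does (fits? I J B) then w (B ─ I) else 0)
  ∑-𝓜 I J w = trans (∑-map (_─ I) (basesFor M I J) w) (∑-filter (fits? I J) (allSubsets n) _)

  coeff-Mpoly⊗Mpoly : ∀ I₁ J₁ I₂ J₂ →
    coeff (Mpoly M I₁ J₁ ⊗ Mpoly M I₂ J₂) α ≡ ℤ.+ #pairs (contributes? I₁ J₁ I₂ J₂)
  coeff-Mpoly⊗Mpoly I₁ J₁ I₂ J₂ = trans (coeff-generatingPoly-⊗ (𝓜 M I₁ J₁) (𝓜 M I₂ J₂) α) (cong ℤ.+_ (begin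
    ∑ (𝓜 M I₁ J₁) (λ A → count (λ B → mono A ⊙ mono B ≟ᵐ α) (𝓜 M I₂ J₂))
      ≡⟨ ∑-𝓜 I₁ J₁ _ ⟩
    ∑ S (λ B₁ → if does (fits? I₁ J₁ B₁) then count (λ B → mono (B₁ ─ I₁) ⊙ mono B ≟ᵐ α) (𝓜 M I₂ J₂) else 0)
      ≡⟨ ∑-cong S (λ B₁ → trans (cong (λ k → if does (fits? I₁ J₁ B₁) then k else 0) (∑-𝓜 I₂ J₂ _))
                                 (if-∑ (fits? I₁ J₁ B₁) S _)) ⟩
    ∑ S (λ B₁ → ∑ S (λ B₂ → if does (fits? I₁ J₁ B₁)
                              then (if does (fits? I₂ J₂ B₂) then 𝟙 (eq? B₁ B₂) else 0) else 0))
      ≡⟨ ∑-cong S (λ B₁ → ∑-cong S (λ B₂ →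
           trans (cong (λ k → if does (fits? I₁ J₁ B₁) then k else 0) (if-𝟙 (fits? I₂ J₂ B₂) (eq? B₁ B₂)))
                 (if-𝟙 (fits? I₁ J₁ B₁) (fits? I₂ J₂ B₂ ×-dec eq? B₁ B₂)))) ⟩
    ∑ S (λ B₁ → ∑ S (λ B₂ → 𝟙 (contributes? I₁ J₁ I₂ J₂ (B₁ , B₂))))
      ≡⟨ ∑-cartesianProduct S S _ ⟨
    #pairs (contributes? I₁ J₁ I₂ J₂) ∎))
    where
    open ≡-Reasoning
    S = allSubsets n
    eq? : ∀ B₁ B₂ → Dec (mono (B₁ ─ I₁) ⊙ mono (B₂ ─ I₂) ≡ α)
    eq? B₁ B₂ = mono (B₁ ─ I₁) ⊙ mono (B₂ ─ I₂) ≟ᵐ α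

  coeff-Mpoly⊗Mpoly⊝Mpoly⊗Mpoly : ∀ I₁ J₁ I₂ J₂ I₃ J₃ I₄ J₄ →
    coeff (Mpoly M I₁ J₁ ⊗ Mpoly M I₂ J₂ ⊝ Mpoly M I₃ J₃ ⊗ Mpoly M I₄ J₄) α ≡
    ℤ.+ #pairs (contributes? I₁ J₁ I₂ J₂) ℤ.- ℤ.+ #pairs (contributes? I₃ J₃ I₄ J₄)
  coeff-Mpoly⊗Mpoly⊝Mpoly⊗Mpoly I₁ J₁ I₂ J₂ I₃ J₃ I₄ J₄ =
    trans (coeff-⊝ (Mpoly M I₁ J₁ ⊗ Mpoly M I₂ J₂) (Mpoly M I₃ J₃ ⊗ Mpoly M I₄ J₄) α)
          (cong₂ ℤ._-_ (coeff-Mpoly⊗Mpoly I₁ J₁ I₂ J₂) (coeff-Mpoly⊗Mpoly I₃ J₃ I₄ J₄))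

0≤+n-+m : ∀ {m n} → m ℕ.≤ n → 0ℤ ≤ ℤ.+ n ℤ.- ℤ.+ m
0≤+n-+m {m} {n} m≤n = subst (0ℤ ≤_) (sym (trans (ℤ.m-n≡m⊖n n m) (ℤ.⊖-≥ m≤n))) (ℤ.+≤+ z≤n)

+[a+k]-+[b+l]-[+a-+b]≡+k-+l : ∀ a b k l →
  (ℤ.+ (a + k) ℤ.- ℤ.+ (b + l)) ℤ.- (ℤ.+ a ℤ.- ℤ.+ b) ≡ ℤ.+ k ℤ.- ℤ.+ l
+[a+k]-+[b+l]-[+a-+b]≡+k-+l a b k l rewrite ℤ.pos-+ a k | ℤ.pos-+ b l =
  solve 4 (λ a b k l → (a :+ k :- (b :+ l)) :- (a :- b) := k :- l) refl (ℤ.+ a) (ℤ.+ b) (ℤ.+ k) (ℤ.+ l)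
  where open +-*-Solver

-- The injection

module _ (M : Matroid n) (rank₃ : HasRank M 3) {e f g : Fin n} (e≢f : e ≢ f)
         (efg-dependent : Dependent M (triple e f g)) (α : Monomial n) where

  ¬Basis₃efg : ¬ Basis M (triple e f g)
  ¬Basis₃efg Hefg = efg-dependent (triple e f g , Hefg , λ x∈ → x∈)

  ContainsG : Subset n × Subset n → Set
  ContainsG (B₁ , B₂) = g ∈ B₁ ⊎ g ∈ B₂

  containsG? : Decidable ContainsG
  containsG? (B₁ , B₂) = g ∈? B₁ ⊎-dec g ∈? B₂

  Mixed MixedAvoidingG Joint JointAvoidingG : Subset n × Subset n → Set
  Mixed          = Contributes M α ⁅ e ⁆ ⁅ f ⁆ ⁅ f ⁆ ⁅ e ⁆
  MixedAvoidingG = Contributes M α ⁅ e ⁆ (⁅ f ⁆ ∪ ⁅ g ⁆) ⁅ f ⁆ (⁅ e ⁆ ∪ ⁅ g ⁆)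
  Joint          = Contributes M α (⁅ e ⁆ ∪ ⁅ f ⁆) ⊥ ⊥ (⁅ e ⁆ ∪ ⁅ f ⁆)
  JointAvoidingG = Contributes M α (⁅ e ⁆ ∪ ⁅ f ⁆) ⁅ g ⁆ ⊥ (triple e f g)

  mixed? : Decidable Mixed
  mixed? = contributes? M α ⁅ e ⁆ ⁅ f ⁆ ⁅ f ⁆ ⁅ e ⁆
  mixedAvoidingG? : Decidable MixedAvoidingG
  mixedAvoidingG? = contributes? M α ⁅ e ⁆ (⁅ f ⁆ ∪ ⁅ g ⁆) ⁅ f ⁆ (⁅ e ⁆ ∪ ⁅ g ⁆)
  joint? : Decidable Joint
  joint? = contributes? M α (⁅ e ⁆ ∪ ⁅ f ⁆) ⊥ ⊥ (⁅ e ⁆ ∪ ⁅ f ⁆)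
  jointAvoidingG? : Decidable JointAvoidingG
  jointAvoidingG? = contributes? M α (⁅ e ⁆ ∪ ⁅ f ⁆) ⁅ g ⁆ ⊥ (triple e f g)

  MixedWithG JointWithG : Subset n × Subset n → Set
  MixedWithG p = Mixed p × ContainsG p
  JointWithG p = Joint p × ContainsG p

  mixedWithG? : Decidable MixedWithG
  mixedWithG? p = mixed? p ×-dec containsG? p
  jointWithG? : Decidable JointWithG
  jointWithG? p = joint? p ×-dec containsG? p

  count-mixed : #pairs mixed? ≡ #pairs mixedAvoidingG? + #pairs mixedWithG?
  count-mixed = count-split mixed? mixedAvoidingG? containsG? (allPairs n) restrict extend
    where
    restrict : ∀ {p} → MixedAvoidingG p → Mixed p × ¬ ContainsG p
    restrict ((HB₁ , e⊆B₁ , B₁∩fg≡⊥) , (HB₂ , f⊆B₂ , B₂∩eg≡⊥) , μ≡α) =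
      ((HB₁ , e⊆B₁ , ∩≡⊥-antitone (p⊆p∪q _) B₁∩fg≡⊥) ,
       (HB₂ , f⊆B₂ , ∩≡⊥-antitone (p⊆p∪q _) B₂∩eg≡⊥) , μ≡α) ,
      λ { (inj₁ g∈B₁) → ∩≡⊥⇒∉ B₁∩fg≡⊥ (q⊆p∪q _ _ (x∈⁅x⁆ g)) g∈B₁
        ; (inj₂ g∈B₂) → ∩≡⊥⇒∉ B₂∩eg≡⊥ (q⊆p∪q _ _ (x∈⁅x⁆ g)) g∈B₂ }
    extend : ∀ {p} → Mixed p → ¬ ContainsG p → MixedAvoidingG p
    extend ((HB₁ , e⊆B₁ , B₁∩f≡⊥) , (HB₂ , f⊆B₂ , B₂∩e≡⊥) , μ≡α) ¬G =
      (HB₁ , e⊆B₁ , ∩-∪≡⊥ B₁∩f≡⊥ (∉⇒∩⁅x⁆≡⊥ (¬G ∘ inj₁))) ,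
      (HB₂ , f⊆B₂ , ∩-∪≡⊥ B₂∩e≡⊥ (∉⇒∩⁅x⁆≡⊥ (¬G ∘ inj₂))) , μ≡α

  count-joint : #pairs joint? ≡ #pairs jointAvoidingG? + #pairs jointWithG?
  count-joint = count-split joint? jointAvoidingG? containsG? (allPairs n) restrict extend
    where
    ef⊆efg : ⁅ e ⁆ ∪ ⁅ f ⁆ ⊆ triple e f g
    ef⊆efg = subst ((⁅ e ⁆ ∪ ⁅ f ⁆) ⊆_) (∪-assoc ⁅ e ⁆ ⁅ f ⁆ ⁅ g ⁆) (p⊆p∪q ⁅ g ⁆)
    restrict : ∀ {p} → JointAvoidingG p → Joint p × ¬ ContainsG p
    restrict ((HB₁ , ef⊆B₁ , B₁∩g≡⊥) , (HB₂ , ⊥⊆B₂ , B₂∩efg≡⊥) , μ≡α) =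
      ((HB₁ , ef⊆B₁ , ∩≡⊥-antitone ⊥⊆ B₁∩g≡⊥) ,
       (HB₂ , ⊥⊆B₂ , ∩≡⊥-antitone ef⊆efg B₂∩efg≡⊥) , μ≡α) ,
      λ { (inj₁ g∈B₁) → ∩≡⊥⇒∉ B₁∩g≡⊥ (x∈⁅x⁆ g) g∈B₁
        ; (inj₂ g∈B₂) → ∩≡⊥⇒∉ B₂∩efg≡⊥ z∈triple g∈B₂ }
    extend : ∀ {p} → Joint p → ¬ ContainsG p → JointAvoidingG p
    extend ((HB₁ , ef⊆B₁ , _) , (HB₂ , ⊥⊆B₂ , B₂∩ef≡⊥) , μ≡α) ¬G =
      (HB₁ , ef⊆B₁ , ∉⇒∩⁅x⁆≡⊥ (¬G ∘ inj₁)) ,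
      (HB₂ , ⊥⊆B₂ , subst (λ J → _ ∩ J ≡ ⊥) (∪-assoc ⁅ e ⁆ ⁅ f ⁆ ⁅ g ⁆)
                          (∩-∪≡⊥ B₂∩ef≡⊥ (∉⇒∩⁅x⁆≡⊥ (¬G ∘ inj₂)))) , μ≡α

  record JointPair (B₁ B₂ : Subset n) : Set where
    field
      basis₁   : Basis M B₁
      basis₂   : Basis M B₂
      e∈B₁     : e ∈ B₁
      f∈B₁     : f ∈ B₁
      g∉B₁     : g ∉ B₁
      g∈B₂     : g ∈ B₂
      e∉B₂     : e ∉ B₂
      f∉B₂     : f ∉ B₂
      monomial : mono (B₁ ─ (⁅ e ⁆ ∪ ⁅ f ⁆)) ⊙ mono (B₂ ─ ⊥) ≡ α

    e≢g : e ≢ g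
    e≢g refl = e∉B₂ g∈B₂

    f≢g : f ≢ g
    f≢g refl = f∉B₂ g∈B₂

    exchange-monomial : ∀ {x y} → x ∉ B₂ → x ≢ g → y ≢ g → ⁅ x ⁆ ∪ ⁅ y ⁆ ≡ ⁅ e ⁆ ∪ ⁅ f ⁆ →
                        mono (((B₁ - x) ∪ ⁅ g ⁆) - y) ⊙ mono (((B₂ - g) ∪ ⁅ x ⁆) - x) ≡ α
    exchange-monomial {x} {y} x∉B₂ x≢g y≢g xy≡ef = begin
      mono (((B₁ - x) ∪ ⁅ g ⁆) - y) ⊙ mono (((B₂ - g) ∪ ⁅ x ⁆) - x) ≡⟨ mono-exchange g∉B₁ g∈B₂ x∉B₂ x≢g y≢g ⟩
      mono (B₁ ─ (⁅ x ⁆ ∪ ⁅ y ⁆)) ⊙ mono B₂                         ≡⟨ cong₂ (λ I B → mono (B₁ ─ I) ⊙ mono B)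
                                                                             xy≡ef (sym (p─⊥≡p B₂)) ⟩
      mono (B₁ ─ (⁅ e ⁆ ∪ ⁅ f ⁆)) ⊙ mono (B₂ ─ ⊥)                    ≡⟨ monomial ⟩
      α                                                              ∎
      where open ≡-Reasoning

  jointPair : ∀ {B₁ B₂} → JointWithG (B₁ , B₂) → JointPair B₁ B₂
  jointPair {B₁} {B₂} (((HB₁ , ef⊆B₁ , _) , (HB₂ , _ , B₂∩ef≡⊥) , μ≡α) , g∈B₁∪B₂) = record
    { basis₁ = HB₁ ; basis₂ = HB₂ ; e∈B₁ = e∈B₁ ; f∈B₁ = f∈B₁ ; g∉B₁ = g∉B₁ ; g∈B₂ = g∈B₂
    ; e∉B₂ = ∩≡⊥⇒∉ B₂∩ef≡⊥ (x∈p∪q⁺ (inj₁ (x∈⁅x⁆ e)))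
    ; f∉B₂ = ∩≡⊥⇒∉ B₂∩ef≡⊥ (x∈p∪q⁺ (inj₂ (x∈⁅x⁆ f)))
    ; monomial = μ≡α }
    where
    e∈B₁ = ef⊆B₁ (x∈p∪q⁺ (inj₁ (x∈⁅x⁆ e)))
    f∈B₁ = ef⊆B₁ (x∈p∪q⁺ (inj₂ (x∈⁅x⁆ f)))
    g∉B₁ : g ∉ B₁
    g∉B₁ g∈B₁ = efg-dependent (B₁ , HB₁ , λ x∈efg → case ∈-triple⁻ x∈efg of λ where
      (inj₁ refl)        → e∈B₁
      (inj₂ (inj₁ refl)) → f∈B₁
      (inj₂ (inj₂ refl)) → g∈B₁)
    g∈B₂ : g ∈ B₂
    g∈B₂ = case g∈B₁∪B₂ of λ where
      (inj₁ g∈B₁) → ⊥-elim (g∉B₁ g∈B₁)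
      (inj₂ g∈B₂) → g∈B₂

  swapsWithF? : ∀ B₁ B₂ → Dec (Basis M ((B₁ - f) ∪ ⁅ g ⁆) × Basis M ((B₂ - g) ∪ ⁅ f ⁆))
  swapsWithF? B₁ B₂ = basis? M ((B₁ - f) ∪ ⁅ g ⁆) ×-dec basis? M ((B₂ - g) ∪ ⁅ f ⁆)

  -- Trade f for g if this yields two bases; otherwise trading e for g does (basis-exchange-e-or-f),
  -- and the two sets are swapped so that the first one contains e but not f.
  φ : Subset n × Subset n → Subset n × Subset n
  φ (B₁ , B₂) with swapsWithF? B₁ B₂
  ... | yes _ = (B₁ - f) ∪ ⁅ g ⁆ , (B₂ - g) ∪ ⁅ f ⁆
  ... | no _  = (B₂ - g) ∪ ⁅ e ⁆ , (B₁ - e) ∪ ⁅ g ⁆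

  φ-maps : ∀ {p} → JointWithG p → MixedWithG (φ p)
  φ-maps {B₁ , B₂} jw with swapsWithF? B₁ B₂
  ... | yes (H₁ , H₂) =
    ((H₁ , x∈p⇒⁅x⁆⊆p (z∈p-x∪y e∈B₁ e≢f) , ∉⇒∩⁅x⁆≡⊥ (x∉p-x∪y f≢g)) ,
     (H₂ , x∈p⇒⁅x⁆⊆p y∈p-x∪y , ∉⇒∩⁅x⁆≡⊥ (z∉p-x∪y e∉B₂ e≢f)) ,
     exchange-monomial f∉B₂ f≢g e≢g (∪-comm ⁅ f ⁆ ⁅ e ⁆)) ,
    inj₁ y∈p-x∪y
    where open JointPair (jointPair jw)
  ... | no ¬swapsWithF
    with basis-exchange-e-or-f M rank₃ ¬Basis₃efg e≢f basis₁ e∈B₁ f∈B₁ basis₂ g∈B₂ e∉B₂ f∉B₂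
    where open JointPair (jointPair jw)
  ...   | inj₂ swapsWithF = ⊥-elim (¬swapsWithF swapsWithF)
  ...   | inj₁ (H₁ , H₂) =
    ((H₂ , x∈p⇒⁅x⁆⊆p y∈p-x∪y , ∉⇒∩⁅x⁆≡⊥ (z∉p-x∪y f∉B₂ (≢-sym e≢f))) ,
     (H₁ , x∈p⇒⁅x⁆⊆p (z∈p-x∪y f∈B₁ (≢-sym e≢f)) , ∉⇒∩⁅x⁆≡⊥ (x∉p-x∪y e≢g)) ,
     trans (⊙-comm _ _) (exchange-monomial e∉B₂ e≢g f≢g refl)) ,
    inj₂ y∈p-x∪y
    where open JointPair (jointPair jw)

  φ-injective : ∀ {p q} → JointWithG p → JointWithG q → φ p ≡ φ q → p ≡ q
  φ-injective {B₁ , B₂} {C₁ , C₂} jp jq φp≡φq with swapsWithF? B₁ B₂ | swapsWithF? C₁ C₂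
  ... | yes _ | yes _ = cong₂ _,_
    (p-x∪y-injective P.f∈B₁ P.g∉B₁ Q.f∈B₁ Q.g∉B₁ (cong proj₁ φp≡φq))
    (p-x∪y-injective P.g∈B₂ P.f∉B₂ Q.g∈B₂ Q.f∉B₂ (cong proj₂ φp≡φq))
    where
    module P = JointPair (jointPair jp)
    module Q = JointPair (jointPair jq)
  ... | no _  | no _  = cong₂ _,_
    (p-x∪y-injective P.e∈B₁ P.g∉B₁ Q.e∈B₁ Q.g∉B₁ (cong proj₂ φp≡φq))
    (p-x∪y-injective P.g∈B₂ P.e∉B₂ Q.g∈B₂ Q.e∉B₂ (cong proj₁ φp≡φq))
    where
    module P = JointPair (jointPair jp)
    module Q = JointPair (jointPair jq)
  ... | yes _ | no _  = ⊥-elim (x∉p-x∪y (≢-sym Q.e≢g) (subst (g ∈_) (cong proj₁ φp≡φq) y∈p-x∪y))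
    where
    module Q = JointPair (jointPair jq)
  ... | no _  | yes _ = ⊥-elim (x∉p-x∪y (≢-sym P.e≢g) (subst (g ∈_) (sym (cong proj₁ φp≡φq)) y∈p-x∪y))
    where
    module P = JointPair (jointPair jp)

  count-jointWithG≤count-mixedWithG : #pairs jointWithG? ℕ.≤ #pairs mixedWithG?
  count-jointWithG≤count-mixedWithG =
    count-≤-injection jointWithG? mixedWithG? φ φ-maps φ-injective
      (Unique.cartesianProduct⁺ (allSubsets-unique n) (allSubsets-unique n)) (allPairs n)
      (λ _ _ → ∈-cartesianProduct⁺ (∈-allSubsets _) (∈-allSubsets _))

  coeff-ΔM⊝ΔMᵍ : coeff (ΔM M e f ⊝ ΔMᵍ M g e f) α ≡ ℤ.+ #pairs mixedWithG? ℤ.- ℤ.+ #pairs jointWithG?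
  coeff-ΔM⊝ΔMᵍ = begin
    coeff (ΔM M e f ⊝ ΔMᵍ M g e f) α
      ≡⟨ coeff-⊝ (ΔM M e f) (ΔMᵍ M g e f) α ⟩
    coeff (ΔM M e f) α ℤ.- coeff (ΔMᵍ M g e f) α
      ≡⟨ cong₂ ℤ._-_
           (coeff-Mpoly⊗Mpoly⊝Mpoly⊗Mpoly M α ⁅ e ⁆ ⁅ f ⁆ ⁅ f ⁆ ⁅ e ⁆ E∪F ⊥ ⊥ E∪F)
           (coeff-Mpoly⊗Mpoly⊝Mpoly⊗Mpoly M α ⁅ e ⁆ (⁅ f ⁆ ∪ ⁅ g ⁆) ⁅ f ⁆ (⁅ e ⁆ ∪ ⁅ g ⁆) E∪F ⁅ g ⁆ ⊥ (triple e f g)) ⟩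
    (ℤ.+ #pairs mixed? ℤ.- ℤ.+ #pairs joint?) ℤ.- (ℤ.+ mA ℤ.- ℤ.+ jA)
      ≡⟨ cong₂ (λ m j → (ℤ.+ m ℤ.- ℤ.+ j) ℤ.- (ℤ.+ mA ℤ.- ℤ.+ jA)) count-mixed count-joint ⟩
    (ℤ.+ (mA + #pairs mixedWithG?) ℤ.- ℤ.+ (jA + #pairs jointWithG?)) ℤ.- (ℤ.+ mA ℤ.- ℤ.+ jA)
      ≡⟨ +[a+k]-+[b+l]-[+a-+b]≡+k-+l mA jA (#pairs mixedWithG?) (#pairs jointWithG?) ⟩
    ℤ.+ #pairs mixedWithG? ℤ.- ℤ.+ #pairs jointWithG? ∎
    where
    open ≡-Reasoning
    E∪F = ⁅ e ⁆ ∪ ⁅ f ⁆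
    mA  = #pairs mixedAvoidingG?
    jA  = #pairs jointAvoidingG?

lemma3p3 : ∀ {n} (M : Matroid n) → HasRank M 3 →
           (e f g : Fin n) → e ≢ f → g ≢ e → g ≢ f →
           Dependent M (⁅ e ⁆ ∪ ⁅ f ⁆ ∪ ⁅ g ⁆) →
           ∀ (α : Monomial n) → 0ℤ ≤ coeff (ΔM M e f ⊝ ΔMᵍ M g e f) α
lemma3p3 M rank₃ e f g e≢f _ _ efg-dependent α =
  subst (0ℤ ≤_) (sym (coeff-ΔM⊝ΔMᵍ M rank₃ e≢f efg-dependent α))
        (0≤+n-+m (count-jointWithG≤count-mixedWithG M rank₃ e≢f efg-dependent α))
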